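{- Let $G=(V,E)$ be a connected graph with a fixed spanning tree $T$ and a given vertex $u$, and let $\alpha,\beta$ be two proper 3-colourings of $G$. Let $R=c_0,\dots,c_\ell$ be an $(\alpha\to\beta)$-recolouring of length $\ell$. Then $\ell\ge\frac12 T_u(R)$.
   Context: A proper 3-colouring is a map $c:V\to\{1,2,3\}$ with $c(x)\ne c(y)$ for all $xy\in E$. A $(c_0\to c_\ell)$-recolouring of length $\ell$ is a sequence $c_0,\dots,c_\ell$ of proper 3-colourings in which consecutive colourings disagree on at most one vertex. For an edge oriented from $x$ to $y$, $w(c,\overrightarrow{xy})\in\{ -1,1\}$ satisfies $w(c,\overrightarrow{xy})\equiv c(y)-c(x)\pmod 3$; path weights are sums of edge weights; $\overrightarrow{P_{uv}}$ is the $u$–$v$ path in $T$ oriented from $u$ to $v$; $h_{\alpha,u}(c,v)=w(c,\overrightarrow{P_{uv}})-w(\alpha,\overrightarrow{P_{uv}})$. Absolute heights: $H_u^R(c_0,u)=0$; for $i>0$, $H_u^R(c_i,u)=H_u^R(c_{i-1},u)$ if $c_i(u)=c_{i-1}(u)$, $=H_u^R(c_{i-1},u)+2$ if $c_i(u)\equiv c_{i-1}(u)-1\pmod3$, $=H_u^R(c_{i-1},u)-2$ if $c_i(u)\equiv c_{i-1}(u)+1\pmod3$; and $H_u^R(c_i,v)=H_u^R(c_i,u)+h_{\alpha,u}(c_i,v)$. Write $H_u^R(\beta,v)$ for $H_u^R(c_\ell,v)$. The total height of $R$ is $T_u(R)=\sum_{v\in V}|H_u^R(\beta,v)|$. -}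

module Defs where

open import Data.Nat as ℕ using (ℕ; zero; suc; _<_; _≤_)
open import Data.Integer as ℤ using (ℤ; +_; -[1+_]; ∣_∣)
open import Data.Fin using (Fin; zero; suc)
open import Data.List using (List; []; _∷_; map; length; drop)
open import Data.Nat.ListAction using (sum)
open import Data.List.Relation.Unary.Unique.Propositional using (Unique)
open import Data.List.Base using (allFin)
open import Data.Product using (Σ; _×_; ∃)
open import Relation.Binary.PropositionalEquality using (_≡_; _≢_)
open import Relation.Nullary using (¬_)

Rel : ℕ → Set₁
Rel n = Fin n → Fin n → Set

record IsGraph {n : ℕ} (E : Rel n) : Set where
  field
    sym   : ∀ {x y} → E x y → E y x
    irrefl : ∀ {x} → ¬ E x x

data Walk {n : ℕ} (R : Rel n) : Fin n → Fin n → Set where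
  []  : ∀ {x} → Walk R x x
  _∷_ : ∀ {x y z} → R x y → Walk R y z → Walk R x z

verts : ∀ {n} {R : Rel n} {x y} → Walk R x y → List (Fin n)
verts {x = x} [] = x ∷ []
verts {x = x} (_ ∷ p) = x ∷ verts p

walkLength : ∀ {n} {R : Rel n} {x y} → Walk R x y → ℕ
walkLength [] = 0
walkLength (_ ∷ p) = suc (walkLength p)

IsPath : ∀ {n} {R : Rel n} {x y} → Walk R x y → Set
IsPath p = Unique (verts p)

Connected : ∀ {n} → Rel n → Set
Connected {n} R = (x y : Fin n) → Walk R x y

HasCycle : ∀ {n} → Rel n → Set
HasCycle {n} R = Σ (Fin n) λ x → Σ (Walk R x x) λ c →
  (3 ≤ walkLength c) × Unique (drop 1 (verts c))

record IsSpanningTree {n : ℕ} (E : Rel n) (T : Rel n) : Set where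
  field
    sub       : ∀ {x y} → T x y → E x y
    sym       : ∀ {x y} → T x y → T y x
    connected : Connected T
    acyclic   : ¬ HasCycle T

-- colours {1,2,3} are represented by Fin 3 (only differences mod 3 matter)
Colouring : ℕ → Set
Colouring n = Fin n → Fin 3

Proper : ∀ {n} → Rel n → Colouring n → Set
Proper {n} E c = ∀ {x y : Fin n} → E x y → c x ≢ c y

-- w(a → b) ∈ {-1,1} with w ≡ b - a (mod 3), for a ≠ b (0 if a = b; never used)
wCol : Fin 3 → Fin 3 → ℤ
wCol zero zero = + 0
wCol zero (suc zero) = + 1
wCol zero (suc (suc zero)) = -[1+ 0 ]
wCol (suc zero) zero = -[1+ 0 ]
wCol (suc zero) (suc zero) = + 0
wCol (suc zero) (suc (suc zero)) = + 1
wCol (suc (suc zero)) zero = + 1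
wCol (suc (suc zero)) (suc zero) = -[1+ 0 ]
wCol (suc (suc zero)) (suc (suc zero)) = + 0

wEdge : ∀ {n} → Colouring n → Fin n → Fin n → ℤ
wEdge c x y = wCol (c x) (c y)

wWalk : ∀ {n} {R : Rel n} {x y} → Colouring n → Walk R x y → ℤ
wWalk c [] = + 0
wWalk {x = x} c (_∷_ {y = y} _ p) = wEdge c x y ℤ.+ wWalk c p

hRel : ∀ {n} {R : Rel n} {u v} → Colouring n → Colouring n → Walk R u v → ℤ
hRel α c P = wWalk c P ℤ.- wWalk α P

-- change of the absolute height of u when its colour goes from a to b:
-- 0 if b = a, +2 if b ≡ a - 1, -2 if b ≡ a + 1
heightStep : Fin 3 → Fin 3 → ℤ
heightStep a b = ℤ.- (+ 2 ℤ.* wCol a b)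

Hu : ∀ {n} → (ℕ → Colouring n) → Fin n → ℕ → ℤ
Hu cs u zero = + 0
Hu cs u (suc i) = Hu cs u i ℤ.+ heightStep (cs i u) (cs (suc i) u)

H : ∀ {n} {T : Rel n} {u : Fin n} → (ℕ → Colouring n) → Colouring n →
    ((v : Fin n) → Walk T u v) → ℕ → Fin n → ℤ
H {u = u} cs α P i v = Hu cs u i ℤ.+ hRel α (cs i) (P v)

totalHeight : ∀ {n} {T : Rel n} {u : Fin n} → (ℕ → Colouring n) → Colouring n →
    ((v : Fin n) → Walk T u v) → ℕ → ℕ
totalHeight {n} cs α P ℓ = sum (map (λ v → ∣ H cs α P ℓ v ∣) (allFin n))

-- (α → β)-recolouring c_0,…,c_ℓ (values of cs beyond ℓ are irrelevant)
record IsRecolouring {n : ℕ} (E : Rel n) (α β : Colouring n)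
                     (ℓ : ℕ) (cs : ℕ → Colouring n) : Set where
  field
    start  : ∀ x → cs 0 x ≡ α x
    finish : ∀ x → cs ℓ x ≡ β x
    proper : ∀ i → i ≤ ℓ → Proper E (cs i)
    single : ∀ i → i < ℓ → ∀ x y →
             cs i x ≢ cs (suc i) x → cs i y ≢ cs (suc i) y → x ≡ y

module Submission where

open import Defs
open import Data.Nat using (ℕ; _≤_; _*_)
open import Data.Fin using (Fin)

open import Data.Nat as ℕ using (zero; suc; z≤n; _+_)
import Data.Nat.Properties as ℕ
open import Data.Nat.ListAction using (sum)
open import Algebra.Properties.CommutativeSemigroup ℕ.+-commutativeSemigroup
  using (interchange)
open import Data.Fin as Fin using ()
import Data.Fin.Properties as Fin
open import Data.Integer as ℤ using (ℤ; +_; ∣_∣)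
import Data.Integer.Properties as ℤ
open import Data.Integer.Tactic.RingSolver using (solve-∀)
open import Data.List using ([]; _∷_; map; tabulate; allFin)
import Data.List.Properties as List
open import Data.Sum using (_⊎_; inj₁; inj₂)
open import Function using (_∘_)
open import Relation.Nullary using (yes; no; contradiction)
open import Relation.Nullary.Decidable
  using (from-yes; decidable-stable; ¬?; _→-dec_; _⊎-dec_)
open import Relation.Binary.PropositionalEquality

-- Recolouring a single vertex x from a to b changes the weight of each edge
-- yz by δ z − δ y, where δ is heightStep a b at x and 0 elsewhere. Along a
-- tree path P_uv this telescopes, and the change δ u of the absolute height of
-- u cancels the −δ u, so every height H(v) changes by exactly δ v. A step
-- therefore raises the total height by at most ∣δ x∣ ≤ 2, and the total height
-- of c₀ = α is 0.

heightStep-refl : ∀ a → heightStep a a ≡ + 0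
heightStep-refl = from-yes (Fin.all? λ a → heightStep a a ℤ.≟ + 0)

∣heightStep∣≤2 : ∀ a b → ∣ heightStep a b ∣ ≤ 2
∣heightStep∣≤2 = from-yes (Fin.all? λ a → Fin.all? λ b → ∣ heightStep a b ∣ ℕ.≤? 2)

wCol-step : ∀ a a' b b' → a ≢ b → a' ≢ b' → a ≡ a' ⊎ b ≡ b' →
            wCol a' b' ≡ wCol a b ℤ.+ (heightStep b b' ℤ.- heightStep a a')
wCol-step = from-yes (Fin.all? λ a → Fin.all? λ a' → Fin.all? λ b → Fin.all? λ b' →
  ¬? (a Fin.≟ b) →-dec ¬? (a' Fin.≟ b') →-dec (a Fin.≟ a' ⊎-dec b Fin.≟ b') →-dec
  wCol a' b' ℤ.≟ wCol a b ℤ.+ (heightStep b b' ℤ.- heightStep a a'))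

∣heightStep∣≢0⇒≢ : ∀ {a b} → ∣ heightStep a b ∣ ≢ 0 → a ≢ b
∣heightStep∣≢0⇒≢ {a} ∣δ∣≢0 refl = ∣δ∣≢0 (cong ∣_∣ (heightStep-refl a))

heightChange : ∀ {n} → Colouring n → Colouring n → Fin n → ℤ
heightChange c c' v = heightStep (c v) (c' v)

wWalk-cong : ∀ {n} {R : Rel n} {c d : Colouring n} → (∀ x → c x ≡ d x) →
             ∀ {a b} (p : Walk R a b) → wWalk c p ≡ wWalk d p
wWalk-cong c≗d [] = refl
wWalk-cong c≗d {a} (_∷_ {y = y} _ p) =
  cong₂ ℤ._+_ (cong₂ wCol (c≗d a) (c≗d y)) (wWalk-cong c≗d p)

module SingleVertexStep {n : ℕ} {R : Rel n} {c c' : Colouring n}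
  (proper  : ∀ {x y} → R x y → c x ≢ c y)
  (proper' : ∀ {x y} → R x y → c' x ≢ c' y)
  (single  : ∀ x y → c x ≢ c' x → c y ≢ c' y → x ≡ y)
  where

  private
    δ : Fin n → ℤ
    δ = heightChange c c'

  endpoint-unchanged : ∀ {x y} → R x y → c x ≡ c' x ⊎ c y ≡ c' y
  endpoint-unchanged {x} {y} xy with c x Fin.≟ c' x | c y Fin.≟ c' y
  ... | yes x-fixed | _ = inj₁ x-fixed
  ... | no _ | yes y-fixed = inj₂ y-fixed
  ... | no x-moved | no y-moved =
    contradiction (cong c (single x y x-moved y-moved)) (proper xy)

  wEdge-step : ∀ {x y} → R x y → wEdge c' x y ≡ wEdge c x y ℤ.+ (δ y ℤ.- δ x)
  wEdge-step {x} {y} xy =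
    wCol-step (c x) (c' x) (c y) (c' y) (proper xy) (proper' xy) (endpoint-unchanged xy)

  wWalk-step : ∀ {a b} (p : Walk R a b) → wWalk c' p ≡ wWalk c p ℤ.+ (δ b ℤ.- δ a)
  wWalk-step {a} [] = sym (trans (ℤ.+-identityˡ _) (ℤ.+-inverseʳ (δ a)))
  wWalk-step {a} {b} (_∷_ {y = y} ay p) = begin
    wEdge c' a y ℤ.+ wWalk c' p
      ≡⟨ cong₂ ℤ._+_ (wEdge-step ay) (wWalk-step p) ⟩
    (wEdge c a y ℤ.+ (δ y ℤ.- δ a)) ℤ.+ (wWalk c p ℤ.+ (δ b ℤ.- δ y))
      ≡⟨ telescope (wEdge c a y) (wWalk c p) (δ a) (δ b) (δ y) ⟩
    (wEdge c a y ℤ.+ wWalk c p) ℤ.+ (δ b ℤ.- δ a) ∎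
    where
    open ≡-Reasoning
    telescope : ∀ e w da db dy →
      (e ℤ.+ (dy ℤ.- da)) ℤ.+ (w ℤ.+ (db ℤ.- dy)) ≡ (e ℤ.+ w) ℤ.+ (db ℤ.- da)
    telescope = solve-∀

sum-map-mono-≤ : ∀ {A : Set} {f g : A → ℕ} → (∀ x → f x ≤ g x) →
                 ∀ xs → sum (map f xs) ≤ sum (map g xs)
sum-map-mono-≤ f≤g [] = z≤n
sum-map-mono-≤ f≤g (x ∷ xs) = ℕ.+-mono-≤ (f≤g x) (sum-map-mono-≤ f≤g xs)

sum-map-+ : ∀ {A : Set} (f g : A → ℕ) xs →
            sum (map (λ x → f x + g x) xs) ≡ sum (map f xs) + sum (map g xs)
sum-map-+ f g [] = refl
sum-map-+ f g (x ∷ xs) = begin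
  (f x + g x) + sum (map (λ x → f x + g x) xs) ≡⟨ cong ((f x + g x) ℕ.+_) (sum-map-+ f g xs) ⟩
  (f x + g x) + (sum (map f xs) + sum (map g xs)) ≡⟨ interchange (f x) (g x) _ _ ⟩
  (f x + sum (map f xs)) + (g x + sum (map g xs)) ∎
  where open ≡-Reasoning

sum-map-≡0 : ∀ {A : Set} {f : A → ℕ} → (∀ x → f x ≡ 0) → ∀ xs → sum (map f xs) ≡ 0
sum-map-≡0 f≡0 [] = refl
sum-map-≡0 f≡0 (x ∷ xs) = cong₂ _+_ (f≡0 x) (sum-map-≡0 f≡0 xs)

sum-tabulate-≤-singleSupport : ∀ {m k} (f : Fin m → ℕ) →
  (∀ v w → f v ≢ 0 → f w ≢ 0 → v ≡ w) → (∀ v → f v ≤ k) →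
  sum (tabulate f) ≤ k
sum-tabulate-≤-singleSupport {zero} f single f≤k = z≤n
sum-tabulate-≤-singleSupport {suc m} {k} f single f≤k with f Fin.zero ℕ.≟ 0
... | yes f₀≡0 = begin
  f Fin.zero + sum (tabulate (f ∘ Fin.suc)) ≡⟨ cong (ℕ._+ sum (tabulate (f ∘ Fin.suc))) f₀≡0 ⟩
  sum (tabulate (f ∘ Fin.suc))             ≤⟨ tail≤k ⟩
  k                                         ∎
  where
  open ℕ.≤-Reasoning
  tail≤k : sum (tabulate (f ∘ Fin.suc)) ≤ k
  tail≤k = sum-tabulate-≤-singleSupport (f ∘ Fin.suc)
             (λ v w fv≢0 fw≢0 → Fin.suc-injective (single _ _ fv≢0 fw≢0))
             (f≤k ∘ Fin.suc)
... | no f₀≢0 = begin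
  f Fin.zero + sum (tabulate (f ∘ Fin.suc)) ≤⟨ ℕ.+-mono-≤ (f≤k Fin.zero) tail≤0 ⟩
  k + 0                                     ≡⟨ ℕ.+-identityʳ k ⟩
  k                                         ∎
  where
  open ℕ.≤-Reasoning
  tail-vanishes : ∀ v → f (Fin.suc v) ≡ 0
  tail-vanishes v = decidable-stable (f (Fin.suc v) ℕ.≟ 0)
    λ fv≢0 → Fin.0≢1+n (single Fin.zero (Fin.suc v) f₀≢0 fv≢0)
  tail≤0 : sum (tabulate (f ∘ Fin.suc)) ≤ 0
  tail≤0 = sum-tabulate-≤-singleSupport (f ∘ Fin.suc)
             (λ v w fv≢0 _ → contradiction (tail-vanishes v) fv≢0)
             (ℕ.≤-reflexive ∘ tail-vanishes)

module Heights {n : ℕ} {E T : Rel n} {u : Fin n}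
  (T⊆E : ∀ {x y} → T x y → E x y) (P : (v : Fin n) → Walk T u v)
  {α β : Colouring n} {ℓ : ℕ} {cs : ℕ → Colouring n}
  (rec : IsRecolouring E α β ℓ cs)
  where

  open IsRecolouring rec

  H-zero : ∀ v → H cs α P 0 v ≡ + 0
  H-zero v = begin
    + 0 ℤ.+ (wWalk (cs 0) (P v) ℤ.- wWalk α (P v)) ≡⟨ ℤ.+-identityˡ _ ⟩
    wWalk (cs 0) (P v) ℤ.- wWalk α (P v)           ≡⟨ cong (ℤ._- wWalk α (P v)) (wWalk-cong start (P v)) ⟩
    wWalk α (P v) ℤ.- wWalk α (P v)                ≡⟨ ℤ.+-inverseʳ (wWalk α (P v)) ⟩
    + 0                                            ∎
    where open ≡-Reasoning

  H-suc : ∀ {i} → i ℕ.< ℓ → ∀ v →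
          H cs α P (suc i) v ≡ H cs α P i v ℤ.+ heightChange (cs i) (cs (suc i)) v
  H-suc {i} i<ℓ v = begin
    (Hu cs u i ℤ.+ δ u) ℤ.+ (wWalk c' (P v) ℤ.- wWalk α (P v))
      ≡⟨ cong (λ w → (Hu cs u i ℤ.+ δ u) ℤ.+ (w ℤ.- wWalk α (P v))) (wWalk-step (P v)) ⟩
    (Hu cs u i ℤ.+ δ u) ℤ.+ ((wWalk c (P v) ℤ.+ (δ v ℤ.- δ u)) ℤ.- wWalk α (P v))
      ≡⟨ rearrange (Hu cs u i) (δ u) (wWalk c (P v)) (δ v) (wWalk α (P v)) ⟩
    (Hu cs u i ℤ.+ (wWalk c (P v) ℤ.- wWalk α (P v))) ℤ.+ δ v ∎
    where
    open ≡-Reasoning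
    c c' : Colouring n
    c = cs i
    c' = cs (suc i)
    δ : Fin n → ℤ
    δ = heightChange c c'
    open SingleVertexStep (λ xy → proper i (ℕ.<⇒≤ i<ℓ) (T⊆E xy))
                          (λ xy → proper (suc i) i<ℓ (T⊆E xy))
                          (single i i<ℓ)
    rearrange : ∀ h du w dv a → (h ℤ.+ du) ℤ.+ ((w ℤ.+ (dv ℤ.- du)) ℤ.- a) ≡ (h ℤ.+ (w ℤ.- a)) ℤ.+ dv
    rearrange = solve-∀

  totalHeight-zero : totalHeight cs α P 0 ≡ 0
  totalHeight-zero = sum-map-≡0 (cong ∣_∣ ∘ H-zero) (allFin n)

  totalHeight-suc : ∀ {i} → i ℕ.< ℓ → totalHeight cs α P (suc i) ≤ 2 + totalHeight cs α P i
  totalHeight-suc {i} i<ℓ = begin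
    sum (map (λ v → ∣ H cs α P (suc i) v ∣) (allFin n))
      ≤⟨ sum-map-mono-≤ triangle (allFin n) ⟩
    sum (map (λ v → ∣ δ v ∣ + ∣ H cs α P i v ∣) (allFin n))
      ≡⟨ sum-map-+ (∣_∣ ∘ δ) (λ v → ∣ H cs α P i v ∣) (allFin n) ⟩
    sum (map (∣_∣ ∘ δ) (allFin n)) + totalHeight cs α P i
      ≤⟨ ℕ.+-monoˡ-≤ (totalHeight cs α P i) total-change≤2 ⟩
    2 + totalHeight cs α P i ∎
    where
    open ℕ.≤-Reasoning
    δ : Fin n → ℤ
    δ = heightChange (cs i) (cs (suc i))
    triangle : ∀ v → ∣ H cs α P (suc i) v ∣ ≤ ∣ δ v ∣ + ∣ H cs α P i v ∣
    triangle v = begin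
      ∣ H cs α P (suc i) v ∣        ≡⟨ cong ∣_∣ (H-suc i<ℓ v) ⟩
      ∣ H cs α P i v ℤ.+ δ v ∣      ≤⟨ ℤ.∣i+j∣≤∣i∣+∣j∣ (H cs α P i v) (δ v) ⟩
      ∣ H cs α P i v ∣ + ∣ δ v ∣    ≡⟨ ℕ.+-comm ∣ H cs α P i v ∣ ∣ δ v ∣ ⟩
      ∣ δ v ∣ + ∣ H cs α P i v ∣    ∎
    total-change≤2 : sum (map (∣_∣ ∘ δ) (allFin n)) ≤ 2
    total-change≤2 = subst (_≤ 2) (cong sum (sym (List.map-tabulate (λ v → v) (∣_∣ ∘ δ))))
      (sum-tabulate-≤-singleSupport (∣_∣ ∘ δ)
        (λ v w δv≢0 δw≢0 → single i i<ℓ v w (∣heightStep∣≢0⇒≢ δv≢0) (∣heightStep∣≢0⇒≢ δw≢0))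
        (λ v → ∣heightStep∣≤2 (cs i v) (cs (suc i) v)))

  totalHeight≤2* : ∀ i → i ≤ ℓ → totalHeight cs α P i ≤ 2 * i
  totalHeight≤2* zero _ = ℕ.≤-reflexive totalHeight-zero
  totalHeight≤2* (suc i) i<ℓ = begin
    totalHeight cs α P (suc i) ≤⟨ totalHeight-suc i<ℓ ⟩
    2 + totalHeight cs α P i   ≤⟨ ℕ.+-monoʳ-≤ 2 (totalHeight≤2* i (ℕ.<⇒≤ i<ℓ)) ⟩
    2 + 2 * i                  ≡⟨ ℕ.*-suc 2 i ⟨
    2 * suc i                  ∎
    where open ℕ.≤-Reasoning

lemma8 : (n : ℕ) (E T : Rel n) → IsGraph E → Connected E →
    IsSpanningTree E T → (u : Fin n) →
    (P : (v : Fin n) → Walk T u v) → ((v : Fin n) → IsPath (P v)) →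
    (α β : Colouring n) → Proper E α → Proper E β →
    (ℓ : ℕ) (cs : ℕ → Colouring n) → IsRecolouring E α β ℓ cs →
    totalHeight cs α P ℓ ≤ 2 * ℓ
lemma8 n E T _ _ tree u P _ α β _ _ ℓ cs rec =
  Heights.totalHeight≤2* (IsSpanningTree.sub tree) P rec ℓ ℕ.≤-refl
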